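{- Let $G$ be an abelian closed subgroup of $\Omega_\infty$. Then: (1) If $G$ is non-trivial and of level $n$, then for each faithful node $w_0\in V_n$ for $G$, the image of $\rho_{w_0}(G)$ in $\Omega_\infty^{\mathrm{ab}}$ (i.e. $\widehat{\phi}(\rho_{w_0}(G))\subseteq\prod_{m\geq1}\mathbb{F}_2$) is $1$-dimensional over $\mathbb{F}_2$. (2) $G$ has infinite index in $\Omega_\infty$.
   Context: $\Omega_\infty$ is the automorphism group of the infinite rooted regular binary tree $T_\infty$, whose vertices are finite binary words (the root being the empty word), and $\Omega_n$ is the automorphism group of the tree truncated at level $n$. Every $\sigma\in\Omega_\infty$ has a digital representation $(\ldots,\sigma_n,\ldots,\sigma_1)$ with $\sigma_n\in\mathbb{F}_2^{2^{n-1}}$ indexed by words $w$ of length $n-1$, determined by $\sigma(wx)=\sigma(w)(x+\sigma_n(w))$ for $x\in\{0,1\}$. Let $\phi_n\colon\Omega_\infty\to\mathbb{F}_2$ send $\sigma$ to the sum of the coordinates of $\sigma_n$; then $\widehat{\phi}=\prod_{n\geq1}\phi_n\colon\Omega_\infty\to\prod_{n\geq1}\mathbb{F}_2$ is the abelianization map, identifying $\Omega_\infty^{\mathrm{ab}}$ with $\prod_{n\ge1}\mathbb{F}_2$. The level of a closed non-trivial subgroup $G\leq\Omega_\infty$ is the smallest integer $n\geq0$ such that the image of $G$ in $\Omega_{n+1}$ is non-trivial. Let $V_n$ be the set of vertices at distance $n$ from the root; if $G$ has level $n$, $G$ fixes each vertex of $V_n$, and for $w\in V_n$ let $\rho_w\colon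 G\to\Omega_\infty$ be the homomorphism obtained by restricting to the subtree $wT_\infty$ and identifying it with $T_\infty$ via $v\mapsto wv$. A vertex $w_0\in V_n$ is a faithful node for $G$ if $\phi_1(\rho_{w_0}(G))\neq\{0\}$. -}

module Defs where

open import Data.Bool using (Bool; true; false; _xor_)
open import Data.Nat using (ℕ; zero; suc; _<_)
open import Data.List using (List; []; _∷_; _++_; map; foldr; length)
open import Data.List.Relation.Unary.Any using (Any)
open import Data.Product using (Σ; ∃; _×_; _,_)
open import Data.Sum using (_⊎_)
open import Relation.Binary.PropositionalEquality using (_≡_)
open import Relation.Nullary using (¬_)

-- A finite binary word (vertex of T∞); the list head is the FIRST letter.
Word : Set
Word = List Bool

-- Digital representation (portrait) of an element σ ∈ Ω∞:
-- (port σ) w = σ_{|w|+1}(w) ∈ F₂ for every word w.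
Aut : Set
Aut = Word → Bool

_≈_ : Aut → Aut → Set
p ≈ q = ∀ w → p w ≡ q w

-- Action on vertices: σ(wx) = σ(w)(x + σ_n(w)).
act : Aut → Word → Word
act p []      = []
act p (x ∷ v) = (x xor p []) ∷ act (λ u → p (x ∷ u)) v

actInv : Aut → Word → Word
actInv p []      = []
actInv p (x ∷ v) = (x xor p []) ∷ actInv (λ u → p ((x xor p []) ∷ u)) v

idAut : Aut
idAut _ = false

-- σ ∘ τ (apply τ first, then σ).
_∘ᴬ_ : Aut → Aut → Aut
(σ ∘ᴬ τ) w = τ w xor σ (act τ w)

invAut : Aut → Aut
invAut σ w = σ (actInv σ w)

Subset : Set₁
Subset = Aut → Set

record IsSubgroup (G : Subset) : Set where
  field
    has-id  : G idAut
    closed∘ : ∀ {g h} → G g → G h → G (g ∘ᴬ h)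
    closed⁻ : ∀ {g} → G g → G (invAut g)

-- σ and τ agree on all words of length < n (same image in Ω_n).
AgreeBelow : ℕ → Aut → Aut → Set
AgreeBelow n σ τ = ∀ w → length w < n → σ w ≡ τ w

-- Closed in the profinite topology: contains every limit point.
IsClosed : Subset → Set
IsClosed G = ∀ σ → (∀ n → ∃ λ g → G g × AgreeBelow n σ g) → G σ

IsAbelian : Subset → Set
IsAbelian G = ∀ {g h} → G g → G h → (g ∘ᴬ h) ≈ (h ∘ᴬ g)

NonTrivial : Subset → Set
NonTrivial G = ∃ λ g → G g × ¬ (g ≈ idAut)

-- G has level n: image in Ω_n trivial, image in Ω_{n+1} non-trivial.
HasLevel : Subset → ℕ → Set
HasLevel G n =
  (∀ g → G g → AgreeBelow n g idAut) ×
  (∃ λ g → G g × ∃ λ w → length w ≡ n × g w ≡ true)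

ρ : Word → Aut → Aut
ρ w σ u = σ (w ++ u)

words : ℕ → List Word
words zero    = [] ∷ []
words (suc k) = map (false ∷_) (words k) ++ map (true ∷_) (words k)

xorSum : List Bool → Bool
xorSum = foldr _xor_ false

-- φ_{m} with m = k+1: sum of coordinates of σ_{k+1}.
φ : ℕ → Aut → Bool
φ k σ = xorSum (map σ (words k))

-- φ̂ : Ω∞ → ∏_{m≥1} F₂, with coordinate m = k+1 stored at index k.
φ̂ : Aut → (ℕ → Bool)
φ̂ σ k = φ k σ

FaithfulNode : Subset → ℕ → Word → Set
FaithfulNode G n w₀ = length w₀ ≡ n × ∃ λ g → G g × φ 0 (ρ w₀ g) ≡ true

-- The image φ̂(ρ_{w₀}(G)) ⊆ ∏ F₂ is 1-dimensional over F₂,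
-- i.e. it equals {0, v} for some v ≠ 0.
ImageOneDim : Subset → Word → Set
ImageOneDim G w₀ =
  ∃ λ (v : ℕ → Bool) →
    (∃ λ k → v k ≡ true) ×
    (∃ λ g → G g × (∀ k → φ̂ (ρ w₀ g) k ≡ v k)) ×
    (∀ g → G g → (∀ k → φ̂ (ρ w₀ g) k ≡ false) ⊎ (∀ k → φ̂ (ρ w₀ g) k ≡ v k))

InfiniteIndex : Subset → Set
InfiniteIndex G = ¬ (∃ λ (cs : List Aut) → ∀ σ → Any (λ c → G (invAut c ∘ᴬ σ)) cs)

-- Let a ∈ G be such that A = ρ_{w₀}(a) swaps the root, and let B = ρ_{w₀}(g) for g ∈ G; B
-- commutes with A because G is trivial below level n.  Summing the portraits of BA and AB
-- over the left subtree at level k gives φ_{k+1}(B) = 0 if B fixes the root and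
-- φ_{k+1}(B) = φ_{k+1}(A) otherwise, so φ̂ takes only the values 0 and φ̂(A) on ρ_{w₀}(G).
--
-- For the index, suppose finitely many cosets c G cover Ω∞.  If some element of G swapped
-- the root, the previous dichotomy (at w₀ = root) would contradict the pigeonhole principle
-- applied to the swaps at the leftmost vertices of levels 1, 2, …, whose φ̂ are pairwise
-- different.  So G fixes the root, and its restriction to the left subtree is again abelian
-- and is covered by the restrictions of the root-fixing representatives; these are strictly
-- fewer, since the root swap lies in a coset whose representative swaps the root.

module Submission where

open import Defs
open import Data.Nat using (ℕ)
open import Data.Product using (_×_)

open import Algebra.Bundles using (CommutativeRing)
open import Data.Bool using (Bool; true; false; not; _xor_; _≟_)
open import Data.Bool.Properties
  using (xor-assoc; xor-comm; xor-same; xor-identityʳ; xor-annihilates-not; not-involutive; ¬-not; xor-∧-commutativeRing)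
open import Algebra.Properties.CommutativeSemigroup
  (CommutativeRing.+-commutativeSemigroup xor-∧-commutativeRing) using (interchange)
open import Data.Fin using (Fin; toℕ)
open import Data.Fin.Properties using (pigeonhole)
open import Data.List using (List; []; _∷_; [_]; _++_; map; filter; length; lookup)
open import Data.List.Properties using (map-++; map-∘; map-cong; length-map; filter-notAll)
open import Data.List.Membership.Propositional using (find; lose)
open import Data.List.Membership.Propositional.Properties using (∈-map⁺; ∈-filter⁺)
open import Data.List.Relation.Unary.Any as Any using (Any)
open import Data.List.Relation.Unary.Any.Properties using (lookup-result)
open import Data.Nat using (suc; zero; _<_; _≡ᵇ_; z≤n; s≤s)
open import Data.Nat.Properties using (<-≤-trans; n<1+n)
open import Data.Product using (∃; ∃₂; _,_)
open import Data.Sum using (_⊎_; inj₁; inj₂)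
open import Function using (_∘_)
open import Relation.Nullary using (¬_; contradiction)
open import Relation.Binary.PropositionalEquality using (_≡_; refl; sym; trans; cong; cong₂; subst; module ≡-Reasoning; _→-setoid_)
import Relation.Binary.Reasoning.Setoid as SetoidReasoning

module ≈-Reasoning = SetoidReasoning (Word →-setoid Bool)

xor-swap : ∀ {x y z w} → x xor z ≡ y xor w → y xor z ≡ x xor w
xor-swap {false} {false} eq = eq
xor-swap {true}  {true}  eq = eq
xor-swap {false} {true}  {w = w} eq = trans (cong not eq) (not-involutive w)
xor-swap {true}  {false} {z = z} eq = trans (sym (not-involutive z)) (cong not eq)

xor-cancelˡ-both : ∀ c x y → (c xor x) xor (c xor y) ≡ x xor y
xor-cancelˡ-both false x y = refl
xor-cancelˡ-both true  x y = xor-annihilates-not x y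

xorSum-++ : ∀ xs ys → xorSum (xs ++ ys) ≡ xorSum xs xor xorSum ys
xorSum-++ []       ys = refl
xorSum-++ (x ∷ xs) ys = trans (cong (x xor_) (xorSum-++ xs ys)) (sym (xor-assoc x _ _))

xorSum-map-xor : ∀ {A : Set} (f g : A → Bool) xs →
  xorSum (map (λ x → f x xor g x) xs) ≡ xorSum (map f xs) xor xorSum (map g xs)
xorSum-map-xor f g []       = refl
xorSum-map-xor f g (x ∷ xs) =
  trans (cong ((f x xor g x) xor_) (xorSum-map-xor f g xs)) (interchange (f x) (g x) _ _)

φ-cong : ∀ k {σ τ} → σ ≈ τ → φ k σ ≡ φ k τ
φ-cong k σ≈τ = cong xorSum (map-cong σ≈τ (words k))

φ-xor : ∀ k (σ τ : Aut) → φ k (λ w → σ w xor τ w) ≡ φ k σ xor φ k τ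
φ-xor k σ τ = xorSum-map-xor σ τ (words k)

φ-zero : ∀ σ → φ 0 σ ≡ σ []
φ-zero σ = xor-identityʳ (σ [])

φ-idAut : ∀ k → φ k idAut ≡ false
φ-idAut k = xorSum-false (words k)
  where
  xorSum-false : (ws : List Word) → xorSum (map idAut ws) ≡ false
  xorSum-false []       = refl
  xorSum-false (_ ∷ ws) = xorSum-false ws

φ-suc : ∀ k σ → φ (suc k) σ ≡ φ k (ρ [ false ] σ) xor φ k (ρ [ true ] σ)
φ-suc k σ = begin
    xorSum (map σ (map (false ∷_) ws ++ map (true ∷_) ws))
  ≡⟨ cong xorSum (map-++ σ (map (false ∷_) ws) _) ⟩
    xorSum (map σ (map (false ∷_) ws) ++ map σ (map (true ∷_) ws))
  ≡⟨ xorSum-++ (map σ (map (false ∷_) ws)) _ ⟩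
    xorSum (map σ (map (false ∷_) ws)) xor xorSum (map σ (map (true ∷_) ws))
  ≡⟨ sym (cong₂ _xor_ (cong xorSum (map-∘ ws)) (cong xorSum (map-∘ ws))) ⟩
    φ k (ρ [ false ] σ) xor φ k (ρ [ true ] σ)
  ∎
  where
  open ≡-Reasoning
  ws = words k

φ-children : ∀ k σ b → φ k (ρ [ b ] σ) xor φ k (ρ [ not b ] σ) ≡ φ (suc k) σ
φ-children k σ false = sym (φ-suc k σ)
φ-children k σ true  = trans (xor-comm (φ k (ρ [ true ] σ)) _) (sym (φ-suc k σ))

-- Each σ permutes every level of the tree, so summing over a level ignores it.
φ-act : ∀ k σ τ → φ k (σ ∘ act τ) ≡ φ k σ
φ-act zero    σ τ = refl
φ-act (suc k) σ τ = begin
    φ (suc k) (σ ∘ act τ)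
  ≡⟨ φ-suc k _ ⟩
    φ k (ρ [ τ [] ] σ ∘ act (ρ [ false ] τ)) xor φ k (ρ [ not (τ []) ] σ ∘ act (ρ [ true ] τ))
  ≡⟨ cong₂ _xor_ (φ-act k (ρ [ τ [] ] σ) _) (φ-act k (ρ [ not (τ []) ] σ) _) ⟩
    φ k (ρ [ τ [] ] σ) xor φ k (ρ [ not (τ []) ] σ)
  ≡⟨ φ-children k σ (τ []) ⟩
    φ (suc k) σ
  ∎
  where open ≡-Reasoning

φ-∘ : ∀ k σ τ → φ k (σ ∘ᴬ τ) ≡ φ k τ xor φ k σ
φ-∘ k σ τ = trans (φ-xor k τ (σ ∘ act τ)) (cong (φ k τ xor_) (φ-act k σ τ))

actInv≡act-invAut : ∀ σ w → actInv σ w ≡ act (invAut σ) w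
actInv≡act-invAut σ []      = refl
actInv≡act-invAut σ (x ∷ v) =
  cong ((x xor σ []) ∷_) (actInv≡act-invAut (λ u → σ ((x xor σ []) ∷ u)) v)

φ-invAut : ∀ k σ → φ k (invAut σ) ≡ φ k σ
φ-invAut k σ = trans (φ-cong k (cong σ ∘ actInv≡act-invAut σ)) (φ-act k σ (invAut σ))

φ-invAut-∘ : ∀ k σ τ → φ k (invAut σ ∘ᴬ τ) ≡ φ k σ xor φ k τ
φ-invAut-∘ k σ τ = begin
    φ k (invAut σ ∘ᴬ τ)       ≡⟨ φ-∘ k (invAut σ) τ ⟩
    φ k τ xor φ k (invAut σ)  ≡⟨ cong (φ k τ xor_) (φ-invAut k σ) ⟩
    φ k τ xor φ k σ           ≡⟨ xor-comm (φ k τ) (φ k σ) ⟩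
    φ k σ xor φ k τ           ∎
  where open ≡-Reasoning

act-cong : ∀ {σ τ} → σ ≈ τ → ∀ w → act σ w ≡ act τ w
act-cong σ≈τ []      = refl
act-cong σ≈τ (x ∷ v) = cong₂ _∷_ (cong (x xor_) (σ≈τ [])) (act-cong (σ≈τ ∘ (x ∷_)) v)

actInv-cong : ∀ {σ τ} → σ ≈ τ → ∀ w → actInv σ w ≡ actInv τ w
actInv-cong         σ≈τ []      = refl
actInv-cong {σ} {τ} σ≈τ (x ∷ v) rewrite σ≈τ [] =
  cong ((x xor τ []) ∷_) (actInv-cong (σ≈τ ∘ ((x xor τ []) ∷_)) v)

invAut-cong : ∀ {σ τ} → σ ≈ τ → invAut σ ≈ invAut τ
invAut-cong {σ} σ≈τ w = trans (cong σ (actInv-cong σ≈τ w)) (σ≈τ _)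

∘ᴬ-cong : ∀ {σ σ′ τ τ′} → σ ≈ σ′ → τ ≈ τ′ → (σ ∘ᴬ τ) ≈ (σ′ ∘ᴬ τ′)
∘ᴬ-cong {σ} σ≈σ′ τ≈τ′ w = cong₂ _xor_ (τ≈τ′ w) (trans (cong σ (act-cong τ≈τ′ w)) (σ≈σ′ _))

act-++ : ∀ w₀ {τ} → AgreeBelow (length w₀) τ idAut → ∀ u → act τ (w₀ ++ u) ≡ w₀ ++ act (ρ w₀ τ) u
act-++ []       τ-fixes u = refl
act-++ (x ∷ w₀) τ-fixes u =
  cong₂ _∷_ (trans (cong (x xor_) (τ-fixes [] (s≤s z≤n))) (xor-identityʳ x))
            (act-++ w₀ (λ w |w|< → τ-fixes (x ∷ w) (s≤s |w|<)) u)

ρ-∘ : ∀ w₀ σ {τ} → AgreeBelow (length w₀) τ idAut → ρ w₀ (σ ∘ᴬ τ) ≈ (ρ w₀ σ ∘ᴬ ρ w₀ τ)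
ρ-∘ w₀ σ {τ} τ-fixes u = cong (λ v → τ (w₀ ++ u) xor σ v) (act-++ w₀ τ-fixes u)

ρ-commute : ∀ w₀ {σ τ} → AgreeBelow (length w₀) σ idAut → AgreeBelow (length w₀) τ idAut →
  (σ ∘ᴬ τ) ≈ (τ ∘ᴬ σ) → (ρ w₀ σ ∘ᴬ ρ w₀ τ) ≈ (ρ w₀ τ ∘ᴬ ρ w₀ σ)
ρ-commute w₀ {σ} {τ} σ-fixes τ-fixes comm = begin
  ρ w₀ σ ∘ᴬ ρ w₀ τ  ≈⟨ ρ-∘ w₀ σ τ-fixes ⟨
  ρ w₀ (σ ∘ᴬ τ)     ≈⟨ comm ∘ (w₀ ++_) ⟩
  ρ w₀ (τ ∘ᴬ σ)     ≈⟨ ρ-∘ w₀ τ σ-fixes ⟩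
  ρ w₀ τ ∘ᴬ ρ w₀ σ  ∎
  where open ≈-Reasoning

ρ-invAut : ∀ σ → σ [] ≡ false → ρ [ false ] (invAut σ) ≈ invAut (ρ [ false ] σ)
ρ-invAut σ σ-fixes-root v rewrite σ-fixes-root = refl

module _ {g a : Aut} (a-swaps-root : a [] ≡ true) (g∘a≈a∘g : (g ∘ᴬ a) ≈ (a ∘ᴬ g)) where

  φ-suc-centralizer : ∀ k → φ (suc k) g ≡ φ k (ρ [ false ] a) xor φ k (ρ [ g [] ] a)
  φ-suc-centralizer k = trans (φ-suc k g) (xor-swap {φ k (ρ [ false ] a)} {φ k (ρ [ false ] g)} left-subtrees)
    where
    open ≡-Reasoning
    left-subtrees : φ k (ρ [ false ] a) xor φ k (ρ [ true ] g) ≡ φ k (ρ [ false ] g) xor φ k (ρ [ g [] ] a)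
    left-subtrees = begin
        φ k (ρ [ false ] a) xor φ k (ρ [ true ] g)
      ≡⟨ cong (λ b → φ k (ρ [ false ] a) xor φ k (ρ [ b ] g)) a-swaps-root ⟨
        φ k (ρ [ false ] a) xor φ k (ρ [ a [] ] g)
      ≡⟨ φ-∘ k (ρ [ a [] ] g) (ρ [ false ] a) ⟨
        φ k (ρ [ false ] (g ∘ᴬ a))
      ≡⟨ φ-cong k (g∘a≈a∘g ∘ (false ∷_)) ⟩
        φ k (ρ [ false ] (a ∘ᴬ g))
      ≡⟨ φ-∘ k (ρ [ g [] ] a) (ρ [ false ] g) ⟩
        φ k (ρ [ false ] g) xor φ k (ρ [ g [] ] a)
      ∎

  centralizer-φ̂-fixing-root : g [] ≡ false → ∀ k → φ̂ g k ≡ false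
  centralizer-φ̂-fixing-root g-fixes-root zero    = trans (φ-zero g) g-fixes-root
  centralizer-φ̂-fixing-root g-fixes-root (suc k) = begin
    φ (suc k) g                                        ≡⟨ φ-suc-centralizer k ⟩
    φ k (ρ [ false ] a) xor φ k (ρ [ g [] ] a)         ≡⟨ cong (λ b → φ k (ρ [ false ] a) xor φ k (ρ [ b ] a)) g-fixes-root ⟩
    φ k (ρ [ false ] a) xor φ k (ρ [ false ] a)        ≡⟨ xor-same (φ k (ρ [ false ] a)) ⟩
    false                                              ∎
    where open ≡-Reasoning

  centralizer-φ̂-swapping-root : g [] ≡ true → ∀ k → φ̂ g k ≡ φ̂ a k
  centralizer-φ̂-swapping-root g-swaps-root zero    =
    trans (φ-zero g) (trans g-swaps-root (sym (trans (φ-zero a) a-swaps-root)))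
  centralizer-φ̂-swapping-root g-swaps-root (suc k) = begin
    φ (suc k) g                                        ≡⟨ φ-suc-centralizer k ⟩
    φ k (ρ [ false ] a) xor φ k (ρ [ g [] ] a)         ≡⟨ cong (λ b → φ k (ρ [ false ] a) xor φ k (ρ [ b ] a)) g-swaps-root ⟩
    φ k (ρ [ false ] a) xor φ k (ρ [ true ] a)         ≡⟨ φ-suc k a ⟨
    φ (suc k) a                                        ∎
    where open ≡-Reasoning

faithful-node-image-one-dim : ∀ {G n w₀} → IsAbelian G → HasLevel G n → FaithfulNode G n w₀ →
  ImageOneDim G w₀
faithful-node-image-one-dim {G} {w₀ = w₀} abelian (trivial-below , _) (refl , a , Ga , φ₁ρa≡true) =
  φ̂ (ρ w₀ a) , (0 , φ₁ρa≡true) , (a , Ga , λ _ → refl) , image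
  where
  ρa-swaps-root : ρ w₀ a [] ≡ true
  ρa-swaps-root = trans (sym (φ-zero (ρ w₀ a))) φ₁ρa≡true

  commute : ∀ g → G g → (ρ w₀ g ∘ᴬ ρ w₀ a) ≈ (ρ w₀ a ∘ᴬ ρ w₀ g)
  commute g Gg = ρ-commute w₀ (trivial-below g Gg) (trivial-below a Ga) (abelian Gg Ga)

  image : ∀ g → G g → (∀ k → φ̂ (ρ w₀ g) k ≡ false) ⊎ (∀ k → φ̂ (ρ w₀ g) k ≡ φ̂ (ρ w₀ a) k)
  image g Gg with ρ w₀ g [] in ρg-root
  ... | false = inj₁ (centralizer-φ̂-fixing-root {ρ w₀ g} {ρ w₀ a} ρa-swaps-root (commute g Gg) ρg-root)
  ... | true  = inj₂ (centralizer-φ̂-swapping-root {ρ w₀ g} {ρ w₀ a} ρa-swaps-root (commute g Gg) ρg-root)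

IsDivisionClosed : Subset → Set
IsDivisionClosed P = ∀ {g h} → P g → P h → P (invAut g ∘ᴬ h)

subgroup-division-closed : ∀ {G} → IsSubgroup G → IsDivisionClosed G
subgroup-division-closed G-subgroup Gg Gh = closed∘ (closed⁻ Gg) Gh
  where open IsSubgroup G-subgroup

CosetCover : Subset → List Aut → Set
CosetCover P cs = ∀ σ → Any (λ c → P (invAut c ∘ᴬ σ)) cs

φ-quotient-of-cosets : ∀ k c σ τ → φ k (invAut (invAut c ∘ᴬ σ) ∘ᴬ (invAut c ∘ᴬ τ)) ≡ φ k σ xor φ k τ
φ-quotient-of-cosets k c σ τ = begin
    φ k (invAut (invAut c ∘ᴬ σ) ∘ᴬ (invAut c ∘ᴬ τ))
  ≡⟨ φ-invAut-∘ k (invAut c ∘ᴬ σ) (invAut c ∘ᴬ τ) ⟩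
    φ k (invAut c ∘ᴬ σ) xor φ k (invAut c ∘ᴬ τ)
  ≡⟨ cong₂ _xor_ (φ-invAut-∘ k c σ) (φ-invAut-∘ k c τ) ⟩
    (φ k c xor φ k σ) xor (φ k c xor φ k τ)
  ≡⟨ xor-cancelˡ-both (φ k c) (φ k σ) (φ k τ) ⟩
    φ k σ xor φ k τ
  ∎
  where open ≡-Reasoning

cover-collision : ∀ {P cs} → IsDivisionClosed P → CosetCover P cs → (σ : Fin (suc (length cs)) → Aut) →
  ∃₂ λ i j → toℕ i < toℕ j × ∃ λ d → P d × ∀ k → φ k d ≡ φ k (σ i) xor φ k (σ j)
cover-collision {P} {cs} division-closed cover σ
  with pigeonhole (n<1+n (length cs)) (Any.index ∘ cover ∘ σ)
... | i , j , i<j , same-coset =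
  i , j , i<j , invAut (invAut c ∘ᴬ σ i) ∘ᴬ (invAut c ∘ᴬ σ j) ,
  division-closed (lookup-result (cover (σ i))) P[c⁻¹σⱼ] , λ k → φ-quotient-of-cosets k c (σ i) (σ j)
  where
  c = Any.lookup (cover (σ i))
  P[c⁻¹σⱼ] : P (invAut c ∘ᴬ σ j)
  P[c⁻¹σⱼ] = subst (λ t → P (invAut (lookup cs t) ∘ᴬ σ j)) (sym same-coset) (lookup-result (cover (σ j)))

leftmostSwap : ℕ → Aut
leftmostSwap zero    []          = true
leftmostSwap zero    (_ ∷ _)     = false
leftmostSwap (suc n) (false ∷ u) = leftmostSwap n u
leftmostSwap (suc n) _           = false

φ-leftmostSwap : ∀ k n → φ k (leftmostSwap n) ≡ (k ≡ᵇ n)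
φ-leftmostSwap zero    zero    = refl
φ-leftmostSwap zero    (suc n) = refl
φ-leftmostSwap (suc k) zero    =
  trans (φ-suc k (leftmostSwap zero)) (cong₂ _xor_ (φ-idAut k) (φ-idAut k))
φ-leftmostSwap (suc k) (suc n) = begin
  φ (suc k) (leftmostSwap (suc n))          ≡⟨ φ-suc k (leftmostSwap (suc n)) ⟩
  φ k (leftmostSwap n) xor φ k idAut        ≡⟨ cong (φ k (leftmostSwap n) xor_) (φ-idAut k) ⟩
  φ k (leftmostSwap n) xor false            ≡⟨ xor-identityʳ _ ⟩
  φ k (leftmostSwap n)                      ≡⟨ φ-leftmostSwap k n ⟩
  (k ≡ᵇ n)                                  ∎
  where open ≡-Reasoning

≡ᵇ-separates : ∀ {m n} → m < n → (m ≡ᵇ m) xor (m ≡ᵇ n) ≡ true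
≡ᵇ-separates {zero}  {suc n} _         = refl
≡ᵇ-separates {suc m} {suc n} (s≤s m<n) = ≡ᵇ-separates m<n

cover-fixes-root : ∀ {P cs} → IsAbelian P → IsDivisionClosed P → CosetCover P cs →
  ∀ {a} → P a → a [] ≡ false
cover-fixes-root {P} {cs} abelian division-closed cover {a} Pa = ¬-not a-cannot-swap
  where
  a-cannot-swap : ¬ a [] ≡ true
  a-cannot-swap a-swaps-root with cover-collision {P} {cs} division-closed cover (leftmostSwap ∘ suc ∘ toℕ)
  ... | i , j , i<j , d , Pd , φd = contradiction true≡false λ ()
    where
    open ≡-Reasoning
    d-fixes-root : d [] ≡ false
    d-fixes-root = trans (sym (φ-zero d)) (φd 0)
    true≡false : true ≡ false
    true≡false = begin
      true
        ≡⟨ ≡ᵇ-separates i<j ⟨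
      (toℕ i ≡ᵇ toℕ i) xor (toℕ i ≡ᵇ toℕ j)
        ≡⟨ cong₂ _xor_ (φ-leftmostSwap (suc (toℕ i)) (suc (toℕ i))) (φ-leftmostSwap (suc (toℕ i)) (suc (toℕ j))) ⟨
      φ (suc (toℕ i)) (leftmostSwap (suc (toℕ i))) xor φ (suc (toℕ i)) (leftmostSwap (suc (toℕ j)))
        ≡⟨ φd (suc (toℕ i)) ⟨
      φ (suc (toℕ i)) d
        ≡⟨ centralizer-φ̂-fixing-root {d} {a} a-swaps-root (abelian Pd Pa) d-fixes-root (suc (toℕ i)) ⟩
      false
        ∎

graftLeft : Aut → Aut
graftLeft τ (false ∷ u) = τ u
graftLeft τ _           = false

restrictedReps : List Aut → List Aut
restrictedReps cs = map (ρ [ false ]) (filter (λ c → c [] ≟ false) cs)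

module RootStabilizer (P : Subset) (fixes-root : ∀ {g} → P g → g [] ≡ false) where

  -- Portraits are functions, so the restricted group is taken up to pointwise equality.
  P₀ : Subset
  P₀ τ = ∃ λ g → P g × ρ [ false ] g ≈ τ

  fixes-level-0 : ∀ {g} → P g → AgreeBelow 1 g idAut
  fixes-level-0 Pg []      _         = fixes-root Pg
  fixes-level-0 Pg (_ ∷ _) (s≤s ())

  P₀-abelian : IsAbelian P → IsAbelian P₀
  P₀-abelian abelian {τ} {υ} (g , Pg , g₀≈τ) (h , Ph , h₀≈υ) = begin
    τ ∘ᴬ υ                        ≈⟨ ∘ᴬ-cong g₀≈τ h₀≈υ ⟨
    ρ [ false ] g ∘ᴬ ρ [ false ] h  ≈⟨ ρ-commute [ false ] (fixes-level-0 Pg) (fixes-level-0 Ph) (abelian Pg Ph) ⟩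
    ρ [ false ] h ∘ᴬ ρ [ false ] g  ≈⟨ ∘ᴬ-cong h₀≈υ g₀≈τ ⟩
    υ ∘ᴬ τ                        ∎
    where open ≈-Reasoning

  P₀-division-closed : IsDivisionClosed P → IsDivisionClosed P₀
  P₀-division-closed division-closed {τ} {υ} (g , Pg , g₀≈τ) (h , Ph , h₀≈υ) =
    invAut g ∘ᴬ h , division-closed Pg Ph , (begin
      ρ [ false ] (invAut g ∘ᴬ h)              ≈⟨ ρ-∘ [ false ] (invAut g) (fixes-level-0 Ph) ⟩
      ρ [ false ] (invAut g) ∘ᴬ ρ [ false ] h  ≈⟨ ∘ᴬ-cong {τ = ρ [ false ] h} (ρ-invAut g (fixes-root Pg)) (λ _ → refl) ⟩
      invAut (ρ [ false ] g) ∘ᴬ ρ [ false ] h  ≈⟨ ∘ᴬ-cong (invAut-cong g₀≈τ) h₀≈υ ⟩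
      invAut τ ∘ᴬ υ                            ∎)
    where open ≈-Reasoning

  restricted-cover : ∀ {cs} → CosetCover P cs → CosetCover P₀ (restrictedReps cs)
  restricted-cover cover τ with find (cover (graftLeft τ))
  ... | c , c∈cs , P[c⁻¹τ] =
    lose (∈-map⁺ (ρ [ false ]) (∈-filter⁺ (λ c → c [] ≟ false) c∈cs c-fixes-root))
         (invAut c ∘ᴬ graftLeft τ , P[c⁻¹τ] , λ u → cong (τ u xor_) (ρ-invAut c c-fixes-root (act τ u)))
    where
    c-fixes-root : c [] ≡ false
    c-fixes-root = fixes-root P[c⁻¹τ]

  restrictedReps-shorter : ∀ {cs} → CosetCover P cs → length (restrictedReps cs) < length cs
  restrictedReps-shorter {cs} cover =
    subst (_< length cs) (sym (length-map (ρ [ false ]) (filter (λ c → c [] ≟ false) cs)))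
      (filter-notAll (λ c → c [] ≟ false) cs (Any.map (λ {c} → swaps-root {c}) (cover (leftmostSwap 0))))
    where
    swaps-root : ∀ {c} → P (invAut c ∘ᴬ leftmostSwap 0) → ¬ c [] ≡ false
    swaps-root P[c⁻¹s] c-fixes-root =
      contradiction (trans (sym (cong not c-fixes-root)) (fixes-root P[c⁻¹s])) λ ()

no-short-coset-cover : ∀ m {P} → IsAbelian P → IsDivisionClosed P → ∀ cs → length cs < m → ¬ CosetCover P cs
no-short-coset-cover (suc m) {P} abelian division-closed cs (s≤s |cs|≤m) cover =
  no-short-coset-cover m {P₀} (P₀-abelian abelian) (P₀-division-closed division-closed) (restrictedReps cs)
    (<-≤-trans (restrictedReps-shorter cover) |cs|≤m) (restricted-cover cover)
  where open RootStabilizer P (cover-fixes-root {P} {cs} abelian division-closed cover)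

no-finite-coset-cover : ∀ {P} → IsAbelian P → IsDivisionClosed P → ¬ ∃ (CosetCover P)
no-finite-coset-cover {P} abelian division-closed (cs , cover) =
  no-short-coset-cover (suc (length cs)) {P} abelian division-closed cs (n<1+n (length cs)) cover

proposition3p4 : (G : Subset) → IsSubgroup G → IsClosed G → IsAbelian G →
    ((n : ℕ) → NonTrivial G → HasLevel G n →
      ∀ w₀ → FaithfulNode G n w₀ → ImageOneDim G w₀)
    × InfiniteIndex G
proposition3p4 G subgroup _ abelian =
  (λ _ _ level _ faithful → faithful-node-image-one-dim abelian level faithful) ,
  no-finite-coset-cover {G} abelian (subgroup-division-closed {G} subgroup)
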